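{- In the decremental algorithm $\mathcal{B}$ (described in the context), for the tree $T$ computed by the procedure RepairTree and every node $x$ with $d_{G_0}(x,s)\leq X$, $$d_G(x,s)\leq d^{\mathrm w}_T(x,s)\leq d_{G_0}(x,s)+\kappa\delta .$$
   Context: Let $G$ be an unweighted undirected network with root $s$ undergoing edge deletions; $G$ denotes the current graph. Algorithm $\mathcal{B}$ has parameters $\kappa\geq 1$, $X\geq 1$ and $\delta\geq 1$, and works in phases. At the start of a phase it lets $G_0$ be the current graph, computes a BFS tree $T_0$ of $G_0$ rooted at $s$ up to depth $X$ and the distances $d_{G_0}(\cdot,s)$, sets $k=0$, $T=T_0$, $F_0=T_0$. On deletion of an edge $(u,v)$: $k$ is incremented; if $k$ reaches $\kappa$ a new phase starts; otherwise $(u,v)$ is removed from $F_0$ (if present) and RepairTree is called, and if it reports "distance increase" a new phase starts. RepairTree: set $F=F_0$; let $U$ be the set of nodes of $T_0$ other than $s$ having no parent in $F$. For each $u\in U$, perform a breadth-first search in $G$ from $u$ up to depth $\delta$ looking for a node $v$ with (1) $d_{G_0}(v,s)<d_{G_0}(u,s)$ and (2) $d_G(u,v)\leq\delta$; if such $v$ is found, add to $F$ the edge $(u,v)$ (making $v$ the parent of $u$) with weight $d_G(u,v)$; otherwise return "distance increase". If all searches succeed, set $T=F$ and return it. Edges of $T_0$ have weight $1$, and $d^{\mathrm w}_T(x,y)$ denotes the weighted distance in $T$. -}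

module Defs where

open import Data.Nat using (ℕ; zero; suc; _+_; _*_; _≤_; _<_)
open import Data.Fin using (Fin)
open import Data.Product using (Σ; ∃; _×_; _,_)
open import Data.Sum using (_⊎_)
open import Data.List using (List)
open import Data.List.Membership.Propositional using (_∈_)
open import Data.Maybe using (Maybe; just; nothing)
open import Relation.Nullary using (¬_)
open import Relation.Binary.PropositionalEquality using (_≡_; _≢_)

Graph : ℕ → Set₁
Graph n = Fin n → Fin n → Set

Undirected : ∀ {n} → Graph n → Set
Undirected {n} G = ∀ {x y : Fin n} → G x y → G y x

_∖_ : ∀ {n} → Graph n → List (Fin n × Fin n) → Graph n
(G ∖ D) x y = G x y × ¬ ((x , y) ∈ D) × ¬ ((y , x) ∈ D)

DeletedIn : ∀ {n} → List (Fin n × Fin n) → Fin n → Fin n → Set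
DeletedIn D x y = ((x , y) ∈ D) ⊎ ((y , x) ∈ D)

data Walk {n} (G : Graph n) : Fin n → Fin n → ℕ → Set where
  []  : ∀ {x} → Walk G x x 0
  _∷_ : ∀ {x y z l} → G x y → Walk G y z l → Walk G x z (suc l)

Dist : ∀ {n} → Graph n → Fin n → Fin n → ℕ → Set
Dist G x y d = Walk G x y d × (∀ l → Walk G x y l → d ≤ l)

-- d_G(x,y) ≤ m  (the minimum walk length is at most m; false if x,y disconnected).
DistLE : ∀ {n} → Graph n → Fin n → Fin n → ℕ → Set
DistLE G x y m = ∃ λ l → l ≤ m × Walk G x y l

-- T₀ given by parent pointers p₀ is a BFS tree of G₀ rooted at s up to depth X:
-- its nodes are exactly the x with d_{G₀}(x,s) ≤ X; s is the root (no parent);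
-- every other node x has a parent p adjacent in G₀ with d(p,s) = d(x,s) - 1.
record IsBFSTree {n} (G₀ : Graph n) (s : Fin n) (X : ℕ) (p₀ : Fin n → Maybe (Fin n)) : Set where
  field
    root-nothing : p₀ s ≡ nothing
    has-parent   : ∀ x d → Dist G₀ x s d → d ≤ X → x ≢ s →
                   ∃ λ p → p₀ x ≡ just p
    parent-ok    : ∀ x p → p₀ x ≡ just p →
                   ∃ λ d → Dist G₀ x s (suc d) × suc d ≤ X × G₀ x p × Dist G₀ p s d

-- The tree T = F returned by a successful call of RepairTree, as parent pointers
-- with edge weights: pT x ≡ just (v , w) means v is the parent of x in T and the
-- edge (x,v) has weight w.  Here p₀ describes T₀, D the edges deleted so far in
-- the phase, G = G₀ ∖ D the current graph.
--  * nodes outside T₀ (and s) have no parent;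
--  * a node whose T₀-parent edge is still in F₀ keeps it, with weight 1;
--  * a node u ∈ U (its T₀-parent edge was deleted) gets the parent v found by the
--    search: d_{G₀}(v,s) < d_{G₀}(u,s), d_G(u,v) ≤ δ, and weight d_G(u,v).
record IsRepairedTree {n} (G₀ : Graph n) (D : List (Fin n × Fin n)) (s : Fin n) (δ : ℕ)
         (p₀ : Fin n → Maybe (Fin n)) (pT : Fin n → Maybe (Fin n × ℕ)) : Set where
  field
    no-parent   : ∀ x → p₀ x ≡ nothing → pT x ≡ nothing
    kept-parent : ∀ x p → p₀ x ≡ just p → ¬ DeletedIn D x p → pT x ≡ just (p , 1)
    repaired    : ∀ u p → p₀ u ≡ just p → DeletedIn D u p →
                  ∃ λ v → ∃ λ w → pT u ≡ just (v , w)
                    × (∃ λ du → ∃ λ dv → Dist G₀ u s du × Dist G₀ v s dv × dv < du)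
                    × Dist (G₀ ∖ D) u v w × w ≤ δ

data TDist {n} (pT : Fin n → Maybe (Fin n × ℕ)) (s : Fin n) : Fin n → ℕ → Set where
  root : TDist pT s s 0
  step : ∀ {x v w c} → pT x ≡ just (v , w) → TDist pT s v c → TDist pT s x (w + c)

module Submission where

-- Every T-edge (y , v) either is a surviving T₀-edge of weight 1, or was found by the
-- search for a node y whose T₀-parent edge was deleted; then its weight w is the
-- distance d_G(y,v) ≤ δ.  In both cases d_{G₀}(v,s) < d_{G₀}(y,s) ("the edge descends").
--  * Existence of d^w_T(x,s): follow T-parents; the G₀-level strictly decreases,
--    so the root is reached.
--  * Lower bound d_G(x,s) ≤ d^w_T(x,s): a T-edge of weight w is a G-walk of w edges.
--  * Upper bound: along the T-path the levels strictly decrease, so the nodes left by a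
--    found edge are pairwise distinct and each owns a deleted edge, namely its T₀-parent
--    edge.  We charge each found edge (weight ≤ δ, at least one level down) to that
--    deleted edge by removing it from a list covering all deleted T₀-edges below the
--    current level; hence the weight is at most d_{G₀}(x,s) + |D|·δ ≤ d_{G₀}(x,s) + κδ.

open import Defs
open import Data.Nat using (ℕ; suc; _+_; _*_; _≤_; _<_; z≤n; s≤s)
open import Data.Nat.Properties hiding (_≟_)
open import Data.Fin using (Fin; _≟_)
open import Data.Product using (∃; ∃₂; _×_; _,_; proj₁; proj₂)
import Data.Product.Properties as Product
open import Data.Sum using (_⊎_; inj₁; inj₂)
open import Data.List using (List; length)
open import Data.List.Properties using (length-removeAt′)
open import Data.List.Relation.Unary.All using (All)
open import Data.List.Relation.Unary.Any using (here; there; index)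
open import Data.List.Membership.Propositional using (_∈_; _─_)
open import Data.Maybe using (Maybe; just; nothing)
open import Data.Maybe.Properties using (just-injective)
open import Data.Empty using (⊥-elim)
open import Relation.Nullary using (¬_; Dec; yes; no)
open import Relation.Binary.PropositionalEquality
open import Algebra.Properties.CommutativeSemigroup +-commutativeSemigroup using (x∙yz≈y∙xz)

∈-─ : ∀ {a} {A : Set a} {x y : A} {xs : List A} (p : x ∈ xs) → y ∈ xs → y ≢ x → y ∈ xs ─ p
∈-─ (here refl) (here refl) y≢x = ⊥-elim (y≢x refl)
∈-─ (here _)    (there q)   _   = q
∈-─ (there _)   (here refl) _   = here refl
∈-─ (there p)   (there q)   y≢x = there (∈-─ p q y≢x)

length-─ : ∀ {a} {A : Set a} {x : A} (xs : List A) (p : x ∈ xs) → length xs ≡ suc (length (xs ─ p))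
length-─ xs p = length-removeAt′ xs (index p)

module _ {n : ℕ} where

  open import Data.List.Membership.DecPropositional (Product.≡-dec (_≟_ {n}) (_≟_ {n})) using (_∈?_)

  deleted? : (L : List (Fin n × Fin n)) (x y : Fin n) → Dec (DeletedIn L x y)
  deleted? L x y with (x , y) ∈? L | (y , x) ∈? L
  ... | yes xy | _      = yes (inj₁ xy)
  ... | no _   | yes yx = yes (inj₂ yx)
  ... | no ¬xy | no ¬yx = no λ { (inj₁ xy) → ¬xy xy ; (inj₂ yx) → ¬yx yx }

  Touches : Fin n → Fin n × Fin n → Set
  Touches y e = proj₁ e ≡ y ⊎ proj₂ e ≡ y

  deleted-incident : ∀ {L y p} → DeletedIn L y p → ∃ λ e → e ∈ L × Touches y e
  deleted-incident (inj₁ yp) = _ , yp , inj₁ refl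
  deleted-incident (inj₂ py) = _ , py , inj₂ refl

  touches-≢ : ∀ {e y u v} → Touches y e → u ≢ y → v ≢ y → e ≢ (u , v)
  touches-≢ (inj₁ refl) u≢y _   refl = u≢y refl
  touches-≢ (inj₂ refl) _   v≢y refl = v≢y refl

  deletedIn-─ : ∀ {L e y u v} (q : e ∈ L) → Touches y e → u ≢ y → v ≢ y →
                DeletedIn L u v → DeletedIn (L ─ q) u v
  deletedIn-─ q touch u≢y v≢y (inj₁ uv) = inj₁ (∈-─ q uv λ { refl → touches-≢ touch u≢y v≢y refl })
  deletedIn-─ q touch u≢y v≢y (inj₂ vu) = inj₂ (∈-─ q vu λ { refl → touches-≢ touch v≢y u≢y refl })

  _++ʷ_ : ∀ {G : Graph n} {x y z a b} → Walk G x y a → Walk G y z b → Walk G x z (a + b)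
  []      ++ʷ q = q
  (e ∷ p) ++ʷ q = e ∷ (p ++ʷ q)

  dist-unique : ∀ {G : Graph n} {x y a b} → Dist G x y a → Dist G x y b → a ≡ b
  dist-unique (wa , mina) (wb , minb) = ≤-antisym (mina _ wb) (minb _ wa)

  dist-<-≢ : ∀ {G : Graph n} {x y z a b} → Dist G x z a → Dist G y z b → a < b → x ≢ y
  dist-<-≢ x-a y-b a<b refl = <-irrefl (dist-unique x-a y-b) a<b

-- Weight accounting for a T-edge to a lower level: a surviving T₀-edge costs 1 and
-- spends one level; a found edge costs at most δ and spends one deleted edge.
survived-step : ∀ {c d dv r} → dv < d → c ≤ dv + r → 1 + c ≤ d + r
survived-step {r = r} dv<d c≤ = ≤-trans (s≤s c≤) (+-monoˡ-≤ r dv<d)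

found-step : ∀ {w c d dv δ r} → w ≤ δ → dv < d → c ≤ dv + r → w + c ≤ d + (δ + r)
found-step {w} {c} {d} {dv} {δ} {r} w≤δ dv<d c≤ = begin
  w + c         ≤⟨ +-mono-≤ w≤δ c≤ ⟩
  δ + (dv + r)  ≡⟨ x∙yz≈y∙xz δ dv r ⟩
  dv + (δ + r)  ≤⟨ +-monoˡ-≤ (δ + r) (<⇒≤ dv<d) ⟩
  d + (δ + r)   ∎
  where open ≤-Reasoning

module RepairedTree {n} (G₀ : Graph n) (s : Fin n) (X δ : ℕ) (D : List (Fin n × Fin n))
         (p₀ : Fin n → Maybe (Fin n)) (pT : Fin n → Maybe (Fin n × ℕ))
         (bfs : IsBFSTree G₀ s X p₀) (rep : IsRepairedTree G₀ D s δ p₀ pT) where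

  open IsBFSTree bfs
  open IsRepairedTree rep

  G : Graph n
  G = G₀ ∖ D

  Descends : Fin n → Fin n → Set
  Descends y v = ∃₂ λ dy dv → Dist G₀ y s dy × Dist G₀ v s dv × dv < dy

  descend : ∀ {y v d} → Descends y v → Dist G₀ y s d → ∃ λ dv → Dist G₀ v s dv × dv < d
  descend (dy , dv , y-dy , v-dv , dv<dy) y-d rewrite dist-unique y-d y-dy = dv , v-dv , dv<dy

  parent-descends : ∀ {y p} → p₀ y ≡ just p → Descends y p
  parent-descends {y} {p} eq with parent-ok y p eq
  ... | d , y-d , _ , _ , p-d = suc d , d , y-d , p-d , ≤-refl

  data TreeEdge (y v : Fin n) : ℕ → Set where
    survived : p₀ y ≡ just v → ¬ DeletedIn D y v → TreeEdge y v 1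
    found    : ∀ {p w} → p₀ y ≡ just p → DeletedIn D y p →
               Dist G y v w → w ≤ δ → Descends y v → TreeEdge y v w

  classify : ∀ {y v w} → pT y ≡ just (v , w) → TreeEdge y v w
  classify {y} eq with p₀ y in eq₀
  ... | nothing with () ← trans (sym eq) (no-parent y eq₀)
  ... | just p with deleted? D y p
  ...   | no ¬del with refl ← just-injective (trans (sym eq) (kept-parent y p eq₀ ¬del)) =
          survived eq₀ ¬del
  ...   | yes del with repaired y p eq₀ del
  ...     | v , w , eqT , (dy , dv , y-dy , v-dv , dv<dy) , y-v , w≤δ
          with refl ← just-injective (trans (sym eq) eqT) =
          found eq₀ del y-v w≤δ (dy , dv , y-dy , v-dv , dv<dy)

  tree-edge-descends : ∀ {y v w} → TreeEdge y v w → Descends y v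
  tree-edge-descends (survived eq _)         = parent-descends eq
  tree-edge-descends (found _ _ _ _ descends) = descends

  tree-edge-walk : ∀ {y v w} → TreeEdge y v w → Walk G y v w
  tree-edge-walk {y} {v} (survived eq ¬del) with parent-ok y v eq
  ... | _ , _ , _ , edge , _ = (edge , (λ yv → ¬del (inj₁ yv)) , (λ vy → ¬del (inj₂ vy))) ∷ []
  tree-edge-walk (found _ _ (walk , _) _ _) = walk

  tree-parent : ∀ {y d} → Dist G₀ y s d → d ≤ X → y ≢ s → ∃₂ λ v w → pT y ≡ just (v , w)
  tree-parent {y} {d} y-d d≤X y≢s with has-parent y d y-d d≤X y≢s
  ... | p , eq₀ with deleted? D y p
  ...   | no ¬del = p , 1 , kept-parent y p eq₀ ¬del
  ...   | yes del with repaired y p eq₀ del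
  ...     | v , w , eqT , _ = v , w , eqT

  reaches-root : ∀ k {y d} → Dist G₀ y s d → d ≤ X → d < k → ∃ λ c → TDist pT s y c
  reaches-root (suc k) {y} y-d d≤X (s≤s d≤k) with y ≟ s
  ... | yes refl = 0 , root
  ... | no y≢s with tree-parent y-d d≤X y≢s
  ...   | v , w , eqT with descend (tree-edge-descends (classify eqT)) y-d
  ...     | dv , v-dv , dv<d with reaches-root k v-dv (≤-trans (<⇒≤ dv<d) d≤X) (≤-trans dv<d d≤k)
  ...       | c , path = w + c , step eqT path

  tree-path-walk : ∀ {y c} → TDist pT s y c → Walk G y s c
  tree-path-walk root             = []
  tree-path-walk (step eqT path) = tree-edge-walk (classify eqT) ++ʷ tree-path-walk path

  Covers : List (Fin n × Fin n) → ℕ → Set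
  Covers L m = ∀ {u p d} → p₀ u ≡ just p → DeletedIn D u p → Dist G₀ u s d → d ≤ m → DeletedIn L u p

  deleted-covers : ∀ {m} → Covers D m
  deleted-covers _ del _ _ = del

  -- Charging the deleted T₀-edge (y , p) of a node y at level d ≤ m: removing it from a
  -- cover leaves a shorter list that still covers all levels below d, because the
  -- T₀-edges of lower nodes avoid y.
  uncover : ∀ {L m y p d} → Covers L m → p₀ y ≡ just p → DeletedIn D y p → Dist G₀ y s d → d ≤ m →
            ∃ λ L' → length L ≡ suc (length L') × (∀ {m'} → m' < d → Covers L' m')
  uncover {L} {y = y} {d = d} cov eq₀ del y-d d≤m with deleted-incident (cov eq₀ del y-d d≤m)
  ... | _ , q , touch = L ─ q , length-─ L q , shrink q touch
    where
    shrink : ∀ {e} (q : e ∈ L) → Touches y e → ∀ {m'} → m' < d → Covers (L ─ q) m'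
    shrink q touch m'<d {u} {p'} {d'} eq' del' u-d' d'≤m' =
      deletedIn-─ q touch u≢y p'≢y (cov eq' del' u-d' (≤-trans d'≤m' (≤-trans (<⇒≤ m'<d) d≤m)))
      where
      d'<d : d' < d
      d'<d = ≤-<-trans d'≤m' m'<d
      u≢y : u ≢ y
      u≢y = dist-<-≢ u-d' y-d d'<d
      p'≢y : p' ≢ y
      p'≢y with descend (parent-descends eq') u-d'
      ... | dp , p'-dp , dp<d' = dist-<-≢ p'-dp y-d (<-trans dp<d' d'<d)

  weight-bound : ∀ {L m y d c} → Covers L m → Dist G₀ y s d → d ≤ m → TDist pT s y c →
                 c ≤ d + length L * δ
  weight-bound cov y-d d≤m root = z≤n
  weight-bound cov y-d d≤m (step eqT path) with classify eqT
  ... | survived eq₀ _ with descend (parent-descends eq₀) y-d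
  ...   | dv , v-dv , dv<d =
          survived-step dv<d (weight-bound cov v-dv (≤-trans (<⇒≤ dv<d) d≤m) path)
  weight-bound cov y-d d≤m (step eqT path) | found eq₀ del _ w≤δ descends
    with descend descends y-d | uncover cov eq₀ del y-d d≤m
  ... | dv , v-dv , dv<d | L' , |L|≡1+|L'| , cov' rewrite |L|≡1+|L'| =
          found-step w≤δ dv<d (weight-bound (cov' dv<d) v-dv ≤-refl path)

lemma9 : ∀ {n} (κ X δ : ℕ) → 1 ≤ κ → 1 ≤ X → 1 ≤ δ →
    (G₀ : Graph n) → Undirected G₀ → (s : Fin n) →
    (D : List (Fin n × Fin n)) → All (λ e → G₀ (Data.Product.proj₁ e) (Data.Product.proj₂ e)) D →
    length D < κ →
    (p₀ : Fin n → Maybe (Fin n)) → IsBFSTree G₀ s X p₀ →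
    (pT : Fin n → Maybe (Fin n × ℕ)) → IsRepairedTree G₀ D s δ p₀ pT →
    ∀ x d₀ → Dist G₀ x s d₀ → d₀ ≤ X →
      (∃ λ c → TDist pT s x c)
      × (∀ c → TDist pT s x c → DistLE (G₀ ∖ D) x s c × c ≤ d₀ + κ * δ)
lemma9 κ X δ _ _ _ G₀ _ s D _ |D|<κ p₀ bfs pT rep x d₀ x-d₀ d₀≤X =
  reaches-root (suc d₀) x-d₀ d₀≤X ≤-refl ,
  λ c path → (c , ≤-refl , tree-path-walk path) ,
             ≤-trans (weight-bound deleted-covers x-d₀ ≤-refl path)
                     (+-monoʳ-≤ d₀ (*-monoˡ-≤ δ (<⇒≤ |D|<κ)))
  where open RepairedTree G₀ s X δ D p₀ pT bfs rep
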